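{- Let $u\in F'$ and $x_i\in V_-$. If $\delta(u,x_i)>0$, then $d^*(u)\ge d^*(x_i)$.
   Context: All graphs are finite, simple and undirected. Algorithm naive-fvs on an extended instance $(G,k,F)$, where $F\subseteq V(G)$ induces a forest; degrees are taken in the current graph $G$: 0. If $k<0$, return ``no''. If $V(G)=\emptyset$, return $\emptyset$. 1. If some vertex $v$ has degree less than two, return naive-fvs$(G-\{v\},k,F\setminus\{v\})$. 2. If some $v\in V(G)\setminus F$ has two neighbors in the same component of $G[F]$, recurse on $(G-\{v\},k-1,F)$ and add $v$ to the returned solution (return ``no'' if the recursion does). 3. Pick $v\in V(G)\setminus F$ of maximum degree. 4. If $d(v)=2$: repeatedly, while $G$ has a cycle, delete from $G$ some vertex of the cycle not in $F$ and put it into a set $X$. Return $X$ if $|X|\le k$, else ``no''. 5. Recurse on $(G-\{v\},k-1,F)$; if the result is not ``no'', return it together with $v$. 6. Return naive-fvs$(G,k,F\cup\{v\})$. Search tree. The execution started from $(G,k,\emptyset)$ is a search tree. Each node performs steps 0–4, absorbing the recursive calls of steps 1 and 2. If the node reaches step 5, it has two children, with entry instances $(G-\{v\},k-1,F)$ and $(G,k,F\cup\{v\})$. An execution path is a root-to-leaf path. Fix an execution path whose leaf returns a solution. Let $V_-$ be the set of vertices deleted along it in steps 2, 4 or 5 (the returned solution). Let $F'$ be the set of vertices moved into $F$ by step 6 along it. For $v\in V_-\cup F'$, $d^*(v)$ is the degree of $v$ in the current graph at the moment $v$ is deleted into $V_-$ or moved into $F$. Let $x_1,\dots,x_{|V_-|}$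 list $V_-$ in the order of deletion. For $u\in F'$, a decrement of the degree of $u$ is effective if it occurs after $u$ has been moved into $F$ and lowers the degree from a value at least $3$ (so only the decrements from $d^*(u)$ down to $2$ count). An effective decrement is incurred by $x_i$ if it happens after the deletion of $x_i$ and before the deletion of $x_{i+1}$, or after the deletion of $x_{|V_-|}$ when $i=|V_-|$. Then $\delta(u,x_i)$ denotes the number of effective decrements of $u$ incurred by $x_i$. -}

module Defs where

open import Data.Nat as ℕ using (ℕ; zero; suc; _+_; _≤_; _<_; _≤?_)
open import Data.Integer as ℤ using (ℤ; +_)
open import Data.Fin using (Fin; _≟_)
open import Data.Fin.Subset
  using (Subset; _∈_; _∉_; _∩_; _∪_; _-_; ⁅_⁆; ∣_∣; Nonempty; Empty)
open import Data.Fin.Subset.Properties using (_∈?_)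
open import Data.Bool using (Bool; true; false)
open import Data.Vec using (tabulate)
open import Data.List using (List; []; _∷_; length; _∷ʳ_)
open import Data.List.Relation.Unary.All using (All)
open import Data.List.Relation.Unary.Unique.Propositional using (Unique)
open import Data.List.Relation.Unary.Linked using (Linked)
open import Data.List.Membership.Propositional using () renaming (_∈_ to _∈L_)
open import Data.Product using (Σ; _×_; _,_)
open import Relation.Binary.PropositionalEquality using (_≡_; _≢_)
open import Relation.Nullary using (¬_; yes; no)

record Graph (n : ℕ) : Set where
  field
    adj    : Fin n → Fin n → Bool
    sym    : ∀ u v → adj u v ≡ adj v u
    irrefl : ∀ v → adj v v ≡ false
open Graph public

module _ {n : ℕ} (G : Graph n) where

  Adj : Fin n → Fin n → Set
  Adj u v = adj G u v ≡ true

  nbr : Fin n → Subset n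
  nbr v = tabulate (adj G v)

  deg : Subset n → Fin n → ℕ
  deg V v = ∣ V ∩ nbr v ∣

  data Reach (S : Subset n) : Fin n → Fin n → Set where
    here  : ∀ {a} → Reach S a a
    step  : ∀ {a b c} → Adj a b → b ∈ S → Reach S b c → Reach S a c

  Step2 : Subset n → Subset n → Fin n → Set
  Step2 V F v =
    v ∈ V × v ∉ F ×
    Σ (Fin n) λ a → Σ (Fin n) λ b →
      a ≢ b × Adj v a × Adj v b × a ∈ (V ∩ F) × b ∈ (V ∩ F) × Reach (V ∩ F) a b

  IsCycle : Subset n → Fin n → List (Fin n) → Set
  IsCycle V v ws =
    2 ≤ length ws × Unique (v ∷ ws) × All (_∈ V) (v ∷ ws) ×
    Linked Adj ((v ∷ ws) ∷ʳ v)

  Acyclic : Subset n → Set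
  Acyclic V = ∀ v ws → ¬ IsCycle V v ws

  -- Hypotheses that hold at a node reaching step 3:
  -- steps 0, 1, 2 do not apply.
  record AtStep3 (V F : Subset n) (k : ℤ) : Set where
    field
      k≥0     : + 0 ℤ.≤ k
      nonempty : Nonempty V
      no-step1 : ∀ w → w ∈ V → 2 ≤ deg V w
      no-step2 : ∀ w → ¬ Step2 V F w

  MaxChoice : Subset n → Subset n → Fin n → Set
  MaxChoice V F v = v ∈ V × v ∉ F × (∀ w → w ∈ V → w ∉ F → deg V w ≤ deg V v)

-- Events recorded along an execution path:
--   drop v : v deleted by step 1 (not part of the solution)
--   cut  v : v deleted into V₋ (steps 2, 4 or 5)
--   fix  v : v moved into F by step 6

data Event (n : ℕ) : Set where
  drop cut fix : Fin n → Event n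

module _ {n : ℕ} (G : Graph n) where

  -- The loop of step 4 on (V, F, k); the leaf returns a solution
  -- iff |X| ≤ k, i.e. the budget remaining after deleting X is ≥ 0.
  data Loop4 : Subset n → Subset n → ℤ → List (Event n) → Set where
    done : ∀ {V F k} → Acyclic G V → + 0 ℤ.≤ k → Loop4 V F k []
    del  : ∀ {V F k es} v ws x → IsCycle G V v ws → x ∈L (v ∷ ws) → x ∉ F →
           Loop4 (V - x) F (k ℤ.- + 1) es → Loop4 V F k (cut x ∷ es)

  -- Run V F k es : es is the event sequence of a root-to-leaf path of the
  -- search tree started at (G[V], k, F) whose leaf returns a solution.
  data Run : Subset n → Subset n → ℤ → List (Event n) → Set where
    leaf0 : ∀ {V F k} → + 0 ℤ.≤ k → Empty V → Run V F k []
    step1 : ∀ {V F k es} v → + 0 ℤ.≤ k → Nonempty V →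
            v ∈ V → deg G V v < 2 →
            Run (V - v) (F - v) k es → Run V F k (drop v ∷ es)
    step2 : ∀ {V F k es} v → + 0 ℤ.≤ k → Nonempty V →
            (∀ w → w ∈ V → 2 ≤ deg G V w) → Step2 G V F v →
            Run (V - v) F (k ℤ.- + 1) es → Run V F k (cut v ∷ es)
    step4 : ∀ {V F k es} v → AtStep3 G V F k → MaxChoice G V F v →
            deg G V v ≡ 2 → Loop4 V F k es → Run V F k es
    step5 : ∀ {V F k es} v → AtStep3 G V F k → MaxChoice G V F v →
            deg G V v ≢ 2 →
            Run (V - v) F (k ℤ.- + 1) es → Run V F k (cut v ∷ es)
    step6 : ∀ {V F k es} v → AtStep3 G V F k → MaxChoice G V F v →
            deg G V v ≢ 2 →
            Run V (F ∪ ⁅ v ⁆) k es → Run V F k (fix v ∷ es)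

-- Replaying the events: the current (V(G), F) just before each event.

Snapshot : ℕ → Set
Snapshot n = Subset n × Subset n × Event n

apply : ∀ {n} → Subset n × Subset n → Event n → Subset n × Subset n
apply (V , F) (drop v) = (V - v , F - v)
apply (V , F) (cut v)  = (V - v , F)
apply (V , F) (fix v)  = (V , F ∪ ⁅ v ⁆)

trace : ∀ {n} → Subset n × Subset n → List (Event n) → List (Snapshot n)
trace s [] = []
trace (V , F) (e ∷ es) = (V , F , e) ∷ trace (apply (V , F) e) es

module _ {n : ℕ} (G : Graph n) where

  -- d*(v): degree of v in the current graph when v is cut or fixed
  -- (first such event; 0 if there is none, which never matters below)
  dstar : Fin n → List (Snapshot n) → ℕ
  dstar v [] = 0
  dstar v ((V , F , drop w) ∷ tr) = dstar v tr
  dstar v ((V , F , cut w) ∷ tr) with w ≟ v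
  ... | yes _ = deg G V v
  ... | no  _ = dstar v tr
  dstar v ((V , F , fix w) ∷ tr) with w ≟ v
  ... | yes _ = deg G V v
  ... | no  _ = dstar v tr

  -- 1 if the deletion of w from the current graph (V, F) is an effective
  -- decrement of the degree of u (u ∈ F, u adjacent to w, degree ≥ 3 before)
  effDel : Fin n → Subset n → Subset n → Fin n → ℕ
  effDel u V F w with u ∈? V | u ∈? F | adj G u w | 3 ≤? deg G V u
  ... | yes _ | yes _ | true | yes _ = 1
  ... | _     | _     | _    | _     = 0

  eff : Fin n → Snapshot n → ℕ
  eff u (V , F , drop w) = effDel u V F w
  eff u (V , F , cut w)  = effDel u V F w
  eff u (V , F , fix w)  = 0

  untilNextCut : Fin n → List (Snapshot n) → ℕ
  untilNextCut u [] = 0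
  untilNextCut u ((V , F , cut w) ∷ tr) = 0
  untilNextCut u (s ∷ tr) = eff u s + untilNextCut u tr

  δ : Fin n → Fin n → List (Snapshot n) → ℕ
  δ u x [] = 0
  δ u x ((V , F , cut w) ∷ tr) with w ≟ x
  ... | yes _ = eff u (V , F , cut w) + untilNextCut u tr
  ... | no  _ = δ u x tr
  δ u x (s ∷ tr) = δ u x tr

-- A vertex x deleted before u is moved into F incurs no effective
-- decrement of u: until u is in F its decrements do not count, and once
-- some vertex is moved into F the graph has minimum degree two, so no
-- step-1 deletion can follow before the next deletion into V₋.  Hence x
-- is deleted after u was fixed; x was then a free vertex, so the maximal
-- choice of u gives d(x) ≤ d*(u), and the degree of x only drops later.
module Submission where

open import Defs
open import Data.Nat using (ℕ; _≤_; _<_; _+_; z≤n; _≤?_)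
open import Data.Nat.Properties using (≤-refl; ≤-trans; n≮n)
open import Data.Integer using (+_)
open import Data.Fin using (Fin; _≟_)
open import Data.Fin.Subset
  using (Subset; ⊤; ⊥; _─_; _-_; _∪_; ⁅_⁆; _⊆_; outside) renaming (_∈_ to _∈ₛ_; _∉_ to _∉ₛ_)
open import Data.Fin.Subset.Properties
  using (p⊆q⇒∣p∣≤∣q∣; x∈p∩q⁻; x∈p∩q⁺; p─q⊆p; p⊆p∪q; q⊆p∪q; x∈p∧x≢y⇒x∈p-y; x∈⁅x⁆; _∈?_)
open import Data.Bool using (true; false)
open import Data.Vec using (_∷_; here; there)
open import Data.Product using (_×_; _,_; proj₁; proj₂)
open import Data.List using (List; []; _∷_)
open import Data.List.Membership.Propositional using (_∈_)
open import Data.List.Relation.Unary.Any using (here; there)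
open import Data.List.Relation.Unary.All as All using ()
open import Data.Empty using () renaming (⊥ to Empty; ⊥-elim to contradiction)
open import Relation.Nullary using (yes; no)
open import Relation.Binary.PropositionalEquality using (_≡_; refl; cong₂; subst)

x∈p─q⇒x∉q : ∀ {n} {x : Fin n} (p q : Subset n) → x ∈ₛ p ─ q → x ∉ₛ q
x∈p─q⇒x∉q (_ ∷ p) (outside ∷ q) here ()
x∈p─q⇒x∉q (_ ∷ p) (_ ∷ q) (there x∈p─q) (there x∈q) = x∈p─q⇒x∉q p q x∈p─q x∈q

x∉p-x : ∀ {n} {x : Fin n} (p : Subset n) → x ∉ₛ p - x
x∉p-x {x = x} p x∈p-x = x∈p─q⇒x∉q p ⁅ x ⁆ x∈p-x (x∈⁅x⁆ x)

module _ {n : ℕ} (G : Graph n) where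

  deg-mono : ∀ {U V : Subset n} x → U ⊆ V → deg G U x ≤ deg G V x
  deg-mono {U} x U⊆V = p⊆q⇒∣p∣≤∣q∣ λ y∈U∩N →
    let (y∈U , y∈N) = x∈p∩q⁻ U (nbr G x) y∈U∩N in x∈p∩q⁺ (U⊆V y∈U , y∈N)

  dstar≤deg : ∀ x es (V F : Subset n) → dstar G x (trace (V , F) es) ≤ deg G V x
  dstar≤deg x []            V F = z≤n
  dstar≤deg x (drop w ∷ es) V F =
    ≤-trans (dstar≤deg x es (V - w) (F - w)) (deg-mono x (p─q⊆p V ⁅ w ⁆))
  dstar≤deg x (cut w ∷ es)  V F with w ≟ x
  ... | yes _ = ≤-refl
  ... | no  _ = ≤-trans (dstar≤deg x es (V - w) F) (deg-mono x (p─q⊆p V ⁅ w ⁆))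
  dstar≤deg x (fix w ∷ es)  V F with w ≟ x
  ... | yes _ = ≤-refl
  ... | no  _ = dstar≤deg x es V (F ∪ ⁅ w ⁆)

  Free : Subset n → Subset n → Fin n → Set
  Free V F x = x ∈ₛ V × x ∉ₛ F

  Free-delete : ∀ {V F x} v → Free (V - v) F x → Free V F x
  Free-delete {V} v (x∈V-v , x∉F) = p─q⊆p V ⁅ v ⁆ x∈V-v , x∉F

  Free-drop : ∀ {V F x} v → Free (V - v) (F - v) x → Free V F x
  Free-drop {V} v (x∈V-v , x∉F-v) =
    p─q⊆p V ⁅ v ⁆ x∈V-v , λ x∈F → x∉F-v (x∈p∧x≢y⇒x∈p-y x∈F λ { refl → x∉p-x V x∈V-v })

  Free-fix : ∀ {V F x} v → Free V (F ∪ ⁅ v ⁆) x → Free V F x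
  Free-fix v (x∈V , x∉F∪v) = x∈V , λ x∈F → x∉F∪v (p⊆p∪q ⁅ v ⁆ x∈F)

  loop-cut⇒Free : ∀ {V F k es x} → Loop4 G V F k es → cut x ∈ es → Free V F x
  loop-cut⇒Free (del v ws x (_ , _ , ws⊆V , _) x∈ws x∉F _) (here refl) =
    All.lookup ws⊆V x∈ws , x∉F
  loop-cut⇒Free (del _ _ x _ _ _ l) (there c) = Free-delete x (loop-cut⇒Free l c)

  loop-no-fix : ∀ {V F k es x} → Loop4 G V F k es → fix x ∈ es → Empty
  loop-no-fix (del _ _ _ _ _ _ l) (there f) = loop-no-fix l f

  cut⇒Free : ∀ {V F k es x} → Run G V F k es → cut x ∈ es → Free V F x
  cut⇒Free (step1 v _ _ _ _ r)              (there c)   = Free-drop v (cut⇒Free r c)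
  cut⇒Free (step2 v _ _ _ (v∈V , v∉F , _) _) (here refl) = v∈V , v∉F
  cut⇒Free (step2 v _ _ _ _ r)              (there c)   = Free-delete v (cut⇒Free r c)
  cut⇒Free (step4 v _ _ _ l)                c           = loop-cut⇒Free l c
  cut⇒Free (step5 v _ (v∈V , v∉F , _) _ _)  (here refl) = v∈V , v∉F
  cut⇒Free (step5 v _ _ _ r)                (there c)   = Free-delete v (cut⇒Free r c)
  cut⇒Free (step6 v _ _ _ r)                (there c)   = Free-fix v (cut⇒Free r c)

  fix⇒Free : ∀ {V F k es x} → Run G V F k es → fix x ∈ es → Free V F x
  fix⇒Free (step1 v _ _ _ _ r)             (there f)   = Free-drop v (fix⇒Free r f)
  fix⇒Free (step2 v _ _ _ _ r)             (there f)   = Free-delete v (fix⇒Free r f)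
  fix⇒Free (step4 v _ _ _ l)               f           = contradiction (loop-no-fix l f)
  fix⇒Free (step5 v _ _ _ r)               (there f)   = Free-delete v (fix⇒Free r f)
  fix⇒Free (step6 v _ (v∈V , v∉F , _) _ _) (here refl) = v∈V , v∉F
  fix⇒Free (step6 v _ _ _ r)               (there f)   = Free-fix v (fix⇒Free r f)

  effDel-∉F : ∀ u V F w → u ∉ₛ F → effDel G u V F w ≡ 0
  effDel-∉F u V F w u∉F with u ∈? V | u ∈? F | adj G u w | 3 ≤? deg G V u
  ... | no _  | _       | _     | _     = refl
  ... | yes _ | no _    | _     | _     = refl
  ... | yes _ | yes _   | false | _     = refl
  ... | yes _ | yes _   | true  | no _  = refl
  ... | yes _ | yes u∈F | true  | yes _ = contradiction (u∉F u∈F)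

  untilNextCut-minDeg2 : ∀ {V F k es} u → Run G V F k es →
                         (∀ w → w ∈ₛ V → 2 ≤ deg G V w) →
                         untilNextCut G u (trace (V , F) es) ≡ 0
  untilNextCut-minDeg2 u (leaf0 _ _)                         deg≥2 = refl
  untilNextCut-minDeg2 u (step1 v _ _ v∈V d<2 _)            deg≥2 =
    contradiction (n≮n _ (≤-trans d<2 (deg≥2 v v∈V)))
  untilNextCut-minDeg2 u (step2 _ _ _ _ _ _)                 deg≥2 = refl
  untilNextCut-minDeg2 u (step4 _ _ _ _ (done _ _))          deg≥2 = refl
  untilNextCut-minDeg2 u (step4 _ _ _ _ (del _ _ _ _ _ _ _)) deg≥2 = refl
  untilNextCut-minDeg2 u (step5 _ _ _ _ _)                   deg≥2 = refl
  untilNextCut-minDeg2 u (step6 _ _ _ _ r)                   deg≥2 = untilNextCut-minDeg2 u r deg≥2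

  untilNextCut-∉F : ∀ {V F k es} u → Run G V F k es → u ∉ₛ F →
                    untilNextCut G u (trace (V , F) es) ≡ 0
  untilNextCut-∉F u (leaf0 _ _) u∉F = refl
  untilNextCut-∉F {V} {F} u (step1 v _ _ _ _ r) u∉F =
    cong₂ _+_ (effDel-∉F u V F v u∉F) (untilNextCut-∉F u r λ u∈F-v → u∉F (p─q⊆p F ⁅ v ⁆ u∈F-v))
  untilNextCut-∉F u (step2 _ _ _ _ _ _) u∉F = refl
  untilNextCut-∉F u (step4 _ _ _ _ (done _ _)) u∉F = refl
  untilNextCut-∉F u (step4 _ _ _ _ (del _ _ _ _ _ _ _)) u∉F = refl
  untilNextCut-∉F u (step5 _ _ _ _ _) u∉F = refl
  untilNextCut-∉F u (step6 _ at3 _ _ r) u∉F = untilNextCut-minDeg2 u r (AtStep3.no-step1 at3)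

  cut-before-fix-ineffective : ∀ {V F k es} u x → Run G (V - x) F k es → fix u ∈ es →
    eff G u (V , F , cut x) + untilNextCut G u (trace (V - x , F) es) ≡ 0
  cut-before-fix-ineffective {V} {F} u x r u-fixed =
    cong₂ _+_ (effDel-∉F u V F x u∉F) (untilNextCut-∉F u r u∉F)
    where u∉F = proj₂ (fix⇒Free r u-fixed)

  fix-before-cut-dominates : ∀ {V F k es} u x → MaxChoice G V F u →
    Run G V (F ∪ ⁅ u ⁆) k es → cut x ∈ es →
    dstar G x (trace (V , F ∪ ⁅ u ⁆) es) ≤ deg G V u
  fix-before-cut-dominates {V} {F} {es = es} u x (_ , _ , u-max) r x-cut =
    let (x∈V , x∉F∪u) = cut⇒Free r x-cut in
    ≤-trans (dstar≤deg x es V (F ∪ ⁅ u ⁆)) (u-max x x∈V λ x∈F → x∉F∪u (p⊆p∪q ⁅ u ⁆ x∈F))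

  EffectiveDecrementBound : Subset n → Subset n → List (Event n) → Set
  EffectiveDecrementBound V F es = ∀ u x → fix u ∈ es → cut x ∈ es →
    0 < δ G u x (trace (V , F) es) →
    dstar G x (trace (V , F) es) ≤ dstar G u (trace (V , F) es)

  bound-cut : ∀ {V F k es} v → Run G (V - v) F k es → EffectiveDecrementBound (V - v) F es →
              EffectiveDecrementBound V F (cut v ∷ es)
  bound-cut v r ih u x (there u-fixed) x-cut 0<δ with v ≟ x | v ≟ u
  ... | yes refl | _ =
    contradiction (n≮n 0 (subst (0 <_) (cut-before-fix-ineffective u v r u-fixed) 0<δ))
  ... | no _ | yes refl = contradiction (x∉p-x _ (proj₁ (fix⇒Free r u-fixed)))
  ... | no v≢x | no _ with x-cut
  ...   | here refl = contradiction (v≢x refl)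
  ...   | there x-cut′ = ih u x u-fixed x-cut′ 0<δ

  bound-fix : ∀ {V F k es} v → MaxChoice G V F v → Run G V (F ∪ ⁅ v ⁆) k es →
              EffectiveDecrementBound V (F ∪ ⁅ v ⁆) es →
              EffectiveDecrementBound V F (fix v ∷ es)
  bound-fix v v-max r ih u x u-fixed (there x-cut) 0<δ with v ≟ x | v ≟ u
  ... | yes refl | _ = contradiction (proj₂ (cut⇒Free r x-cut) (q⊆p∪q _ ⁅ v ⁆ (x∈⁅x⁆ v)))
  ... | no _ | yes refl = fix-before-cut-dominates v x v-max r x-cut
  ... | no _ | no v≢u with u-fixed
  ...   | here refl = contradiction (v≢u refl)
  ...   | there u-fixed′ = ih u x u-fixed′ x-cut 0<δ

  bound : ∀ {V F k es} → Run G V F k es → EffectiveDecrementBound V F es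
  bound (leaf0 _ _)           u x ()
  bound (step1 v _ _ _ _ r)   u x (there u-fixed) (there x-cut) = bound r u x u-fixed x-cut
  bound (step2 v _ _ _ _ r)   = bound-cut v r (bound r)
  bound (step4 v _ _ _ l)     u x u-fixed = contradiction (loop-no-fix l u-fixed)
  bound (step5 v _ _ _ r)     = bound-cut v r (bound r)
  bound (step6 v _ v-max _ r) = bound-fix v v-max r (bound r)

proposition1 : ∀ {n} (G : Graph n) (k : ℕ) (es : List (Event n)) →
               Run G ⊤ ⊥ (+ k) es →
               ∀ (u x : Fin n) → fix u ∈ es → cut x ∈ es →
               0 < δ G u x (trace (⊤ , ⊥) es) →
               dstar G x (trace (⊤ , ⊥) es) ≤ dstar G u (trace (⊤ , ⊥) es)
proposition1 G k es run = bound G run
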